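{- Let $n\ge2$ and let $\mathcal{H}=(I,P_2,\dots,P_{n-1},P,Q)$ be an $n$-ary quasigroupoid equipped with a regular action of a group $G$, and assume that $Q$ holds of at least one $(n+1)$-tuple. Then: (1) for any $p_1,\dots,p_{n+1}\in P$, any $g\in G$ and any $i<j$ in $\{1,\dots,n+1\}$, $Q(p_1,\dots,p_{n+1})$ holds if and only if $Q$ holds of the tuple obtained by replacing $p_i$ with $g.p_i$ and $p_j$ with $g^{(-1)^{j-i+1}}.p_j$; (2) $G$ is abelian; (3) writing $G$ additively, if $Q(p_1,\dots,p_{n+1})$ holds then for any $(g_1,\dots,g_{n+1})\in G^{n+1}$, $Q(g_1.p_1,\dots,g_{n+1}.p_{n+1})$ holds if and only if $\sum_{i=1}^{n+1}(-1)^ig_i=0$.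
   Context: An $n$-ary quasigroupoid is a structure with sorts $P_1=I,P_2,\dots,P_n=P$, functions $\pi^k:P_k\to(P_{k-1})^k$ ($2\le k\le n$, $\pi^k_i$ the $i$-th coordinate) and a relation $Q\subseteq P^{n+1}$, where a tuple $(f_1,\dots,f_{k+1})\in(P_k)^{k+1}$ is called compatible if $k=1$ and $f_1\ne f_2$, or $k\ge2$ and $\pi^k_i(f_j)=\pi^k_{j-1}(f_i)$ for all $1\le i<j\le k+1$; the axioms are: each $\pi^k(f)$ is compatible; if $Q(p_1,\dots,p_{n+1})$ then $(p_1,\dots,p_{n+1})$ is compatible; and if $Q(p_1,\dots,p_{n+1})$ then for each $i$, $p_i$ is the unique $x\in P$ with $Q(p_1,\dots,p_{i-1},x,p_{i+1},\dots,p_{n+1})$. A regular action of $G$ on $\mathcal{H}$ is an action of $G$ on $P$ such that $\pi^n(g.p)=\pi^n(p)$ for all $g,p$; $G$ acts regularly (transitively with trivial stabilizers) on each fiber $\{p\in P:\pi^n(p)=w\}$; and whenever $Q(p_1,\dots,p_{n+1})$ holds, then for every $g\in G$ and $i\in\{1,\dots,n\}$, $Q(p_1,\dots,p_{i-1},g.p_i,g.p_{i+1},p_{i+2},\dots,p_{n+1})$ holds. -}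

module Defs where

open import Level using (Level; _⊔_) renaming (suc to lsuc)
open import Data.Nat using (ℕ; zero; suc)
open import Data.Fin using (Fin; zero; suc; inject₁; _≤_)
open import Data.Vec using (Vec; lookup; updateAt; _[_]≔_; []; _∷_)
open import Data.Product using (Σ; _,_; proj₁)
open import Relation.Binary.PropositionalEquality using (_≡_; _≢_)
open import Algebra.Bundles using (Group)

-- A `Tower k` consists of sorts P₁ = I, P₂, …, P_{k+1}, together with
-- the maps πˡ : P_l → (P_{l-1})^l for 2 ≤ l ≤ k+1, each of which is
-- required to land in compatible tuples.  `Top T` is the last sort
-- P_{k+1}, and `Compatible T` is compatibility of a (k+2)-tuple of
-- elements of P_{k+1}.  Tuples are vectors; coordinates are 0-based in
-- Agda (coordinate i here is coordinate i+1 in the paper).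

mutual
  Tower : ℕ → Set₁
  Tower zero    = Set
  Tower (suc k) = Σ (Tower k) λ T →
                  Σ Set λ S →
                  Σ (S → Vec (Top T) (suc (suc k))) λ π →
                  ((x : S) → Compatible T (π x))

  Top : ∀ {k} → Tower k → Set
  Top {zero}  I             = I
  Top {suc k} (T , S , _)   = S

  -- level 1: (f₁ , f₂) compatible iff f₁ ≠ f₂.
  -- level l = k+2 ≥ 2: π_i(f_j) = π_{j-1}(f_i) for 1 ≤ i < j ≤ l+1.
  -- With 0-based i' = i-1 and b = j-2 (both in Fin l), i < j ⇔ i' ≤ b,
  -- f_j = f (suc b), f_i = f (inject₁ i'), π_i = coordinate i',
  -- π_{j-1} = coordinate b.
  Compatible : ∀ {k} (T : Tower k) → Vec (Top T) (suc (suc k)) → Set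
  Compatible {zero}  I f = lookup f zero ≢ lookup f (suc zero)
  Compatible {suc k} (T , S , π , _) f =
    (i b : Fin (suc (suc k))) → i ≤ b →
    lookup (π (lookup f (suc b))) i ≡ lookup (π (lookup f (inject₁ i))) b


topπ : ∀ {k} (T : Tower (suc k)) →
       Top T → Vec (Top (proj₁ T)) (suc (suc k))
topπ (T , S , π , _) = π

-- n-ary quasigroupoid, n = suc k (sorts P₁ … Pₙ, P = Pₙ).

record Quasigroupoid (k : ℕ) : Set₁ where
  field
    tower : Tower k
  P : Set
  P = Top tower
  field
    Q            : Vec P (suc (suc k)) → Set
    Q-compatible : ∀ p → Q p → Compatible tower p
    Q-unique     : ∀ p → Q p → ∀ i x → Q (p [ i ]≔ x) → x ≡ lookup p i

record RegularAction {c ℓ} {k : ℕ} (H : Quasigroupoid (suc k))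
                     (G : Group c ℓ) : Set (c ⊔ ℓ) where
  open Quasigroupoid H
  open Group G
  πⁿ : P → Vec (Top (proj₁ tower)) (suc (suc k))
  πⁿ = topπ tower
  field
    act   : Carrier → P → P
    act-≈ : ∀ {g h} → g ≈ h → ∀ p → act g p ≡ act h p
    act-ε : ∀ p → act ε p ≡ p
    act-∙ : ∀ g h p → act (g ∙ h) p ≡ act g (act h p)
    act-fiber : ∀ g p → πⁿ (act g p) ≡ πⁿ p
    fiber-transitive : ∀ p q → πⁿ p ≡ πⁿ q → Σ Carrier λ g → act g p ≡ q
    fiber-free       : ∀ g p → act g p ≡ p → g ≈ ε
    -- Q(p) ⇒ Q(p₁,…,g.p_i,g.p_{i+1},…,p_{n+1}) for i ∈ {1,…,n}
    -- (0-based: positions inject₁ i and suc i, i : Fin n)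
    Q-shift : ∀ p → Q p → ∀ g (i : Fin (suc (suc k))) →
              Q (updateAt (updateAt p (inject₁ i) (act g)) (suc i) (act g))

module _ {c ℓ} (G : Group c ℓ) where
  open Group G

  signPow : ℕ → Carrier → Carrier
  signPow zero    g = g
  signPow (suc m) g = (signPow m g) ⁻¹

  altSumFrom : ∀ {r} → ℕ → Vec Carrier r → Carrier
  altSumFrom s []       = ε
  altSumFrom s (g ∷ gs) = signPow s g ∙ altSumFrom (suc s) gs

  altSum : ∀ {r} → Vec Carrier r → Carrier
  altSum = altSumFrom 1

module Submission where

-- Adjacent pair shifts preserve Q and are invertible, so they preserve Q in
-- both directions.  Sweeping a weight vector from left to right with such
-- shifts moves all of its weight onto the last coordinate; given Q p,
-- uniqueness of Q and freeness of the action then say that the acted tuple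
-- satisfies Q iff the weight left there is trivial.  In an abelian group that
-- weight is ± the alternating sum, and (1) is the case of a two-point weight
-- vector whose alternating sum vanishes.  Commutativity itself comes from two
-- shifts overlapping in a single coordinate.

open import Defs
open import Level using (Level)
open import Data.Nat using (ℕ; suc; _+_; _∸_)
open import Data.Fin using (Fin; toℕ; _<_)
open import Data.Vec using (Vec; updateAt; zipWith)
open import Data.Product using (_×_; ∃)
open import Function.Bundles using (_⇔_)
open import Algebra.Bundles using (Group)

open import Data.Nat using (zero)
import Data.Nat as ℕ
import Data.Nat.Properties as ℕ
open import Data.Nat.Tactic.RingSolver using (solve-∀)
open import Data.Fin using (zero; suc; inject₁; fromℕ; _≤_)
open import Data.Vec using ([]; _∷_; lookup; replicate)
open import Data.Vec.Properties
  using (updateAt-id-local; updateAt-cong-local; zipWith-replicate₁; map-cong; map-id)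
open import Data.Product using (_,_)
open import Function.Bundles using (mk⇔; Equivalence)
import Function.Properties.Equivalence as ⇔
import Relation.Binary.PropositionalEquality as ≡
open ≡ using (_≡_)
import Algebra.Properties.Group as GroupProperties
import Relation.Binary.Reasoning.Setoid as SetoidReasoning

module _ {c ℓ} (G : Group c ℓ) where
  open Group G
  open GroupProperties G using (ε⁻¹≈ε; ⁻¹-involutive; ⁻¹-injective; ⁻¹-anti-homo-∙)
  open SetoidReasoning setoid

  signPow-cong : ∀ m {x y} → x ≈ y → signPow G m x ≈ signPow G m y
  signPow-cong zero    x≈y = x≈y
  signPow-cong (suc m) x≈y = ⁻¹-cong (signPow-cong m x≈y)

  signPow-ε : ∀ m → signPow G m ε ≈ ε
  signPow-ε zero    = refl
  signPow-ε (suc m) = trans (⁻¹-cong (signPow-ε m)) ε⁻¹≈ε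

  signPow≈ε⇒≈ε : ∀ m {x} → signPow G m x ≈ ε → x ≈ ε
  signPow≈ε⇒≈ε zero    x≈ε = x≈ε
  signPow≈ε⇒≈ε (suc m) x≈ε = signPow≈ε⇒≈ε m (⁻¹-injective (trans x≈ε (sym ε⁻¹≈ε)))

  signPow-⁻¹ : ∀ m x → signPow G m (x ⁻¹) ≈ signPow G (suc m) x
  signPow-⁻¹ zero    x = refl
  signPow-⁻¹ (suc m) x = ⁻¹-cong (signPow-⁻¹ m x)

  signPow-+ : ∀ m n x → signPow G m (signPow G n x) ≡ signPow G (m + n) x
  signPow-+ zero    n x = ≡.refl
  signPow-+ (suc m) n x = ≡.cong _⁻¹ (signPow-+ m n x)

  signPow-double : ∀ d x → signPow G (d + d) x ≈ x
  signPow-double zero    x = refl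
  signPow-double (suc d) x = begin
    signPow G (suc d + suc d) x      ≡⟨ ≡.cong (λ m → signPow G (suc m) x) (ℕ.+-suc d d) ⟩
    signPow G (suc (suc (d + d))) x  ≈⟨ ⁻¹-involutive _ ⟩
    signPow G (d + d) x              ≈⟨ signPow-double d x ⟩
    x                                ∎

  signPow-∸ : ∀ {m n} → m ℕ.≤ n → ∀ x →
              signPow G (n + 1) (signPow G (n ∸ m + 1) x) ≈ signPow G (suc (m + 1)) x
  signPow-∸ {m} {n} m≤n x = begin
    signPow G (n + 1) (signPow G (d + 1) x)  ≡⟨ signPow-+ (n + 1) (d + 1) x ⟩
    signPow G (n + 1 + (d + 1)) x            ≡⟨ ≡.cong (λ e → signPow G e x) exponents ⟩
    signPow G (suc (m + 1) + (d + d)) x      ≡⟨ signPow-+ (suc (m + 1)) (d + d) x ⟨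
    signPow G (suc (m + 1)) (signPow G (d + d) x)  ≈⟨ signPow-cong (suc (m + 1)) (signPow-double d x) ⟩
    signPow G (suc (m + 1)) x                ∎
    where
    d : ℕ
    d = n ∸ m
    same-parity : ∀ m d → m + d + 1 + (d + 1) ≡ suc (m + 1) + (d + d)
    same-parity = solve-∀
    exponents : n + 1 + (d + 1) ≡ suc (m + 1) + (d + d)
    exponents = ≡.trans (≡.cong (λ n′ → n′ + 1 + (d + 1)) (≡.sym (ℕ.m+[n∸m]≡n m≤n)))
                        (same-parity m d)

  altSumFrom-replicate-ε : ∀ r s → altSumFrom G s (replicate r ε) ≈ ε
  altSumFrom-replicate-ε zero    s = refl
  altSumFrom-replicate-ε (suc r) s =
    trans (∙-cong (signPow-ε s) (altSumFrom-replicate-ε r (suc s))) (identityˡ ε)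

  -- The weight left on the last coordinate when the weights are swept
  -- rightwards, each one cancelled by an adjacent pair shift.
  collapseFrom : ∀ {r} → Carrier → Vec Carrier r → Carrier
  collapseFrom c []       = c
  collapseFrom c (a ∷ as) = collapseFrom (c \\ a) as

  collapse : ∀ {r} → Vec Carrier (suc r) → Carrier
  collapse (c ∷ as) = collapseFrom c as

  module _ (comm : ∀ x y → x ∙ y ≈ y ∙ x) where

    signPow-∙ : ∀ m x y → signPow G m (x ∙ y) ≈ signPow G m x ∙ signPow G m y
    signPow-∙ zero    x y = refl
    signPow-∙ (suc m) x y =
      trans (⁻¹-cong (signPow-∙ m x y)) (trans (⁻¹-anti-homo-∙ _ _) (comm _ _))

    altSumFrom-∷-\\ : ∀ {r} s c a (as : Vec Carrier r) →
                      altSumFrom G s (c ∷ a ∷ as) ≈ altSumFrom G (suc s) (c \\ a ∷ as)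
    altSumFrom-∷-\\ s c a as = begin
      signPow G s c ∙ (signPow G (suc s) a ∙ rest)
        ≈⟨ assoc _ _ _ ⟨
      signPow G s c ∙ signPow G (suc s) a ∙ rest
        ≈⟨ ∙-congʳ (∙-congʳ c-sign) ⟨
      signPow G (suc s) (c ⁻¹) ∙ signPow G (suc s) a ∙ rest
        ≈⟨ ∙-congʳ (signPow-∙ (suc s) (c ⁻¹) a) ⟨
      signPow G (suc s) (c \\ a) ∙ rest  ∎
      where
      rest : Carrier
      rest = altSumFrom G (suc (suc s)) as
      c-sign : signPow G (suc s) (c ⁻¹) ≈ signPow G s c
      c-sign = trans (signPow-⁻¹ (suc s) c) (⁻¹-involutive _)

    altSumFrom≈signPow-collapseFrom : ∀ {r} s c (as : Vec Carrier r) →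
                                      altSumFrom G s (c ∷ as) ≈ signPow G (s + r) (collapseFrom c as)
    altSumFrom≈signPow-collapseFrom s c [] =
      trans (identityʳ _) (reflexive (≡.cong (λ e → signPow G e c) (≡.sym (ℕ.+-identityʳ s))))
    altSumFrom≈signPow-collapseFrom {suc r} s c (a ∷ as) =
      trans (altSumFrom-∷-\\ s c a as)
        (trans (altSumFrom≈signPow-collapseFrom (suc s) (c \\ a) as)
          (reflexive (≡.cong (λ e → signPow G e (collapseFrom (c \\ a) as))
                              (≡.sym (ℕ.+-suc s r)))))

    altSum≈ε⇔collapse≈ε : ∀ {r} (a : Vec Carrier (suc r)) → altSum G a ≈ ε ⇔ collapse a ≈ ε
    altSum≈ε⇔collapse≈ε {r} (c ∷ as) = mk⇔
      (λ Σa≈ε → signPow≈ε⇒≈ε (1 + r) (trans (sym Σa≈sign) Σa≈ε))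
      (λ k≈ε → trans Σa≈sign (trans (signPow-cong (1 + r) k≈ε) (signPow-ε (1 + r))))
      where
      Σa≈sign : altSum G (c ∷ as) ≈ signPow G (1 + r) (collapseFrom c as)
      Σa≈sign = altSumFrom≈signPow-collapseFrom 1 c as

    altSumFrom-updateAt-∙ : ∀ {r} s (a : Vec Carrier r) i x →
      altSumFrom G s (updateAt a i (x ∙_)) ≈ signPow G (toℕ i + s) x ∙ altSumFrom G s a
    altSumFrom-updateAt-∙ s (a ∷ as) zero x =
      trans (∙-congʳ (signPow-∙ s x a)) (assoc _ _ _)
    altSumFrom-updateAt-∙ s (a ∷ as) (suc i) x = begin
      signPow G s a ∙ altSumFrom G (suc s) (updateAt as i (x ∙_))
        ≈⟨ ∙-congˡ (altSumFrom-updateAt-∙ (suc s) as i x) ⟩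
      signPow G s a ∙ (signPow G (toℕ i + suc s) x ∙ rest)  ≈⟨ assoc _ _ _ ⟨
      signPow G s a ∙ signPow G (toℕ i + suc s) x ∙ rest    ≈⟨ ∙-congʳ (comm _ _) ⟩
      signPow G (toℕ i + suc s) x ∙ signPow G s a ∙ rest    ≈⟨ assoc _ _ _ ⟩
      signPow G (toℕ i + suc s) x ∙ (signPow G s a ∙ rest)
        ≡⟨ ≡.cong (λ e → signPow G e x ∙ (signPow G s a ∙ rest)) (ℕ.+-suc (toℕ i) s) ⟩
      signPow G (suc (toℕ i) + s) x ∙ (signPow G s a ∙ rest)  ∎
      where
      rest : Carrier
      rest = altSumFrom G (suc s) as

    altSum-pair≈ε : ∀ {r} (i j : Fin r) → i ≤ j → ∀ g →
      altSum G (updateAt (updateAt (replicate r ε) i (g ∙_)) j (signPow G (toℕ j ∸ toℕ i + 1) g ∙_)) ≈ ε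
    altSum-pair≈ε {r} i j i≤j g = begin
      altSum G (updateAt (updateAt (replicate r ε) i (g ∙_)) j (y ∙_))
        ≈⟨ altSumFrom-updateAt-∙ 1 (updateAt (replicate r ε) i (g ∙_)) j y ⟩
      signPow G (toℕ j + 1) y ∙ altSum G (updateAt (replicate r ε) i (g ∙_))
        ≈⟨ ∙-congˡ (altSumFrom-updateAt-∙ 1 (replicate r ε) i g) ⟩
      signPow G (toℕ j + 1) y ∙ (gᵢ ∙ altSum G (replicate r ε))
        ≈⟨ ∙-congˡ (trans (∙-congˡ (altSumFrom-replicate-ε r 1)) (identityʳ gᵢ)) ⟩
      signPow G (toℕ j + 1) y ∙ gᵢ  ≈⟨ ∙-congʳ (signPow-∸ i≤j g) ⟩
      gᵢ ⁻¹ ∙ gᵢ                    ≈⟨ inverseˡ gᵢ ⟩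
      ε                             ∎
      where
      y gᵢ : Carrier
      y = signPow G (toℕ j ∸ toℕ i + 1) g
      gᵢ = signPow G (toℕ i + 1) g

module _ {c ℓ k} {H : Quasigroupoid (suc k)} {G : Group c ℓ} (A : RegularAction H G) where
  open Quasigroupoid H
  open Group G
  open RegularAction A
  open GroupProperties G using (x∙y⁻¹≈ε⇒x≈y; \\-leftDividesˡ)

  act-act : ∀ g h x → act g (act h x) ≡ act (g ∙ h) x
  act-act g h x = ≡.sym (act-∙ g h x)

  act-≈ε : ∀ {g} → g ≈ ε → ∀ x → act g x ≡ x
  act-≈ε g≈ε x = ≡.trans (act-≈ g≈ε x) (act-ε x)

  act-⁻¹-act : ∀ g x → act (g ⁻¹) (act g x) ≡ x
  act-⁻¹-act g x = ≡.trans (act-act (g ⁻¹) g x) (act-≈ε (inverseˡ g) x)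

  act-cancelʳ : ∀ {g h} x → act g x ≡ act h x → g ≈ h
  act-cancelʳ {g} {h} x gx≡hx = x∙y⁻¹≈ε⇒x≈y g h (fiber-free (g ∙ h ⁻¹) (act h x) (begin
    act (g ∙ h ⁻¹) (act h x)    ≡⟨ act-∙ g (h ⁻¹) (act h x) ⟩
    act g (act (h ⁻¹) (act h x)) ≡⟨ ≡.cong (act g) (act-⁻¹-act h x) ⟩
    act g x                      ≡⟨ gx≡hx ⟩
    act h x                      ∎))
    where open ≡.≡-Reasoning

  zipWith-act-ε : ∀ {r} (v : Vec P r) → zipWith act (replicate r ε) v ≡ v
  zipWith-act-ε v = ≡.trans (zipWith-replicate₁ act ε v) (≡.trans (map-cong act-ε v) (map-id v))

  updateAt-zipWith-act : ∀ {r} (a : Vec Carrier r) v i x →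
    updateAt (zipWith act a v) i (act x) ≡ zipWith act (updateAt a i (x ∙_)) v
  updateAt-zipWith-act (a ∷ as) (y ∷ v) zero    x = ≡.cong (_∷ zipWith act as v) (act-act x a y)
  updateAt-zipWith-act (a ∷ as) (y ∷ v) (suc i) x = ≡.cong (act a y ∷_) (updateAt-zipWith-act as v i x)

  updateAt-act-≈ε : ∀ {r} i (v : Vec P r) {z} → z ≈ ε → updateAt v i (act z) ≡ v
  updateAt-act-≈ε i v z≈ε = updateAt-id-local i v (act-≈ε z≈ε (lookup v i))

  ShiftClosed : ∀ {r} → (Vec P (suc r) → Set) → Set c
  ShiftClosed {r} R = ∀ v → R v → ∀ g (i : Fin r) →
    R (updateAt (updateAt v (inject₁ i) (act g)) (suc i) (act g))

  ShiftClosed-∷ : ∀ {r} {R : Vec P (suc (suc r)) → Set} → ShiftClosed R →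
                  ∀ x → ShiftClosed (λ u → R (x ∷ u))
  ShiftClosed-∷ closed x u Rxu g i = closed (x ∷ u) Rxu g (suc i)

  ShiftClosed-head-⇔ : ∀ {r} {R : Vec P (suc (suc r)) → Set} → ShiftClosed R →
    ∀ c a x y u → R (act c x ∷ act a y ∷ u) ⇔ R (x ∷ act (c \\ a) y ∷ u)
  ShiftClosed-head-⇔ {R = R} closed c a x y u = mk⇔
    (λ R-before → ≡.subst R (≡.cong₂ (λ x′ y′ → x′ ∷ y′ ∷ u)
                                      (act-⁻¹-act c x) (act-act (c ⁻¹) a y))
                    (closed _ R-before (c ⁻¹) zero))
    (λ R-after → ≡.subst R (≡.cong (λ y′ → act c x ∷ y′ ∷ u) shifted-back)
                   (closed _ R-after c zero))
    where
    shifted-back : act c (act (c \\ a) y) ≡ act a y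
    shifted-back = ≡.trans (act-act c (c \\ a) y) (act-≈ (\\-leftDividesˡ c a) y)

  sweep : ∀ {r} {R : Vec P (suc r) → Set} → ShiftClosed R → ∀ a v →
          R (zipWith act a v) ⇔ R (updateAt v (fromℕ r) (act (collapse G a)))
  sweep {zero}          closed (c ∷ [])     (x ∷ [])     = ⇔.refl
  sweep {suc r} {R = R} closed (c ∷ a ∷ as) (x ∷ y ∷ v) =
    ⇔.trans (ShiftClosed-head-⇔ closed c a x y (zipWith act as v))
            (sweep (ShiftClosed-∷ {R = R} closed x) (c \\ a ∷ as) (y ∷ v))

  sweep-collapse≈ε : ∀ {r} {R : Vec P (suc r) → Set} → ShiftClosed R → ∀ {a} →
                     collapse G a ≈ ε → ∀ v → R (zipWith act a v) ⇔ R v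
  sweep-collapse≈ε {R = R} closed {a} a≈ε v =
    ≡.subst (λ u → R (zipWith act a v) ⇔ R u) (updateAt-act-≈ε _ v a≈ε) (sweep closed a v)

  Q-updateAt-act⇔ : ∀ {p} → Q p → ∀ i z → Q (updateAt p i (act z)) ⇔ z ≈ ε
  Q-updateAt-act⇔ {p} Qp i z = mk⇔
    (λ Qzp → fiber-free z (lookup p i)
               (Q-unique p Qp i _ (≡.subst Q (updateAt-cong-local i p ≡.refl) Qzp)))
    (λ z≈ε → ≡.subst Q (≡.sym (updateAt-act-≈ε i p z≈ε)) Qp)

  -- Shifting by g at the first two coordinates and by h at the second and
  -- third, in either order, gives tuples that differ only in the second one.
  Q-inhabited⇒comm : ∃ Q → ∀ g h → g ∙ h ≈ h ∙ g
  Q-inhabited⇒comm (x ∷ y ∷ z ∷ w , Qp) g h = act-cancelʳ y (begin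
    act (g ∙ h) y    ≡⟨ act-∙ g h y ⟩
    act g (act h y)  ≡⟨ Q-unique _ Q-g-then-h (suc zero) _ Q-h-then-g ⟩
    act h (act g y)  ≡⟨ act-act h g y ⟩
    act (h ∙ g) y    ∎)
    where
    open ≡.≡-Reasoning
    Q-g-then-h : Q (act g x ∷ act h (act g y) ∷ act h z ∷ w)
    Q-g-then-h = Q-shift _ (Q-shift _ Qp g zero) h (suc zero)
    Q-h-then-g : Q (act g x ∷ act g (act h y) ∷ act h z ∷ w)
    Q-h-then-g = Q-shift _ (Q-shift _ Qp h (suc zero)) g zero

  Q-zipWith-act⇔ : ∀ {p} → Q p → ∀ gs → Q (zipWith act gs p) ⇔ (altSum G gs ≈ ε)
  Q-zipWith-act⇔ {p} Qp gs =
    ⇔.trans (sweep {R = Q} Q-shift gs p)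
      (⇔.trans (Q-updateAt-act⇔ Qp _ _) (⇔.sym (altSum≈ε⇔collapse≈ε G comm gs)))
    where
    comm : ∀ g h → g ∙ h ≈ h ∙ g
    comm = Q-inhabited⇒comm (p , Qp)

  Q-updateAt²⇔ : (∀ g h → g ∙ h ≈ h ∙ g) → ∀ p g (i j : Fin (suc (suc (suc k)))) → i ≤ j →
    Q p ⇔ Q (updateAt (updateAt p i (act g)) j (act (signPow G (toℕ j ∸ toℕ i + 1) g)))
  Q-updateAt²⇔ comm p g i j i≤j =
    ≡.subst (λ u → Q p ⇔ Q u) (≡.sym as-weights)
      (⇔.sym (sweep-collapse≈ε {R = Q} Q-shift
        (Equivalence.to (altSum≈ε⇔collapse≈ε G comm weights) (altSum-pair≈ε G comm i j i≤j g)) p))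
    where
    y : Carrier
    y = signPow G (toℕ j ∸ toℕ i + 1) g
    weights : Vec Carrier (suc (suc (suc k)))
    weights = updateAt (updateAt (replicate _ ε) i (g ∙_)) j (y ∙_)
    as-weights : updateAt (updateAt p i (act g)) j (act y) ≡ zipWith act weights p
    as-weights = begin
      updateAt (updateAt p i (act g)) j (act y)
        ≡⟨ ≡.cong (λ v → updateAt (updateAt v i (act g)) j (act y)) (zipWith-act-ε p) ⟨
      updateAt (updateAt (zipWith act (replicate _ ε) p) i (act g)) j (act y)
        ≡⟨ ≡.cong (λ v → updateAt v j (act y)) (updateAt-zipWith-act (replicate _ ε) p i g) ⟩
      updateAt (zipWith act (updateAt (replicate _ ε) i (g ∙_)) p) j (act y)
        ≡⟨ updateAt-zipWith-act _ p j y ⟩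
      zipWith act weights p  ∎
      where open ≡.≡-Reasoning

proposition2p13 : ∀ {c ℓ} (k : ℕ) (H : Quasigroupoid (suc k)) (G : Group c ℓ)
    (A : RegularAction H G) →
    let open Quasigroupoid H
        open Group G
        open RegularAction A
    in (∃ λ (p : Vec P (suc (suc (suc k)))) → Q p) →
       (∀ (p : Vec P (suc (suc (suc k)))) (g : Carrier) (i j : Fin (suc (suc (suc k)))) → i < j →
          Q p ⇔ Q (updateAt (updateAt p i (act g)) j (act (signPow G (toℕ j ∸ toℕ i + 1) g))))
       × (∀ (x y : Carrier) → x ∙ y ≈ y ∙ x)
       × (∀ (p : Vec P (suc (suc (suc k)))) → Q p → ∀ (gs : Vec Carrier (suc (suc (suc k)))) →
          Q (zipWith act gs p) ⇔ (altSum G gs ≈ ε))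
proposition2p13 k H G A Q-inhabited =
  (λ p g i j i<j → Q-updateAt²⇔ A (Q-inhabited⇒comm A Q-inhabited) p g i j (ℕ.<⇒≤ i<j)) ,
  Q-inhabited⇒comm A Q-inhabited ,
  (λ p Qp → Q-zipWith-act⇔ A Qp)
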